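{- For every integer $n\ge1$ and $m\ge0$, \[ \mathcal{B}_{n,m}^{(k)}(a,q,L)=\sum_{j=1}^{n}q^{n-j}\sum_{i=1}^{n}i!\left\{ {n \atop i} \right\}\left\{ {i-1 \atop j-1} \right\}\mathcal{C}_{j,m}^{(k)}(a,q,L). \]
   Context: Let $k\ge1$ be an integer, $a,q,l_1,\dots,l_k$ nonzero reals, $l=\prod l_i$, $L=(l_1,\dots,l_k)$; denominators $a+j$ ($j\ge0$ integer) assumed nonzero and $l^{a+i}$ means $l^al^i$. Let $s(n,i)$ be the signed Stirling numbers of the first kind ($\frac{1}{i!}(\ln(1+x))^i=\sum_{n\ge i}s(n,i)\frac{x^n}{n!}$) and $\left\{ {n \atop i} \right\}$ the Stirling numbers of the second kind. Define \[ \mathcal{C}_{n,m}^{(k)}(a,q,L)=\frac{(a+m)^k}{a^k}\sum_{i=0}^{n}s(n,i)\frac{q^{n-i}l^{a+i}}{(a+i+m)^k},\qquad \mathcal{B}_{n,m}^{(k)}(a,q,L)=\frac{(a+m)^k}{a^k}\sum_{i=0}^{n}\frac{i!(-q)^{n-i}l^{i+a}}{(a+m+i)^k}\left\{ {n \atop i} \right\}. \] -}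

module Defs where

open import Level using (_⊔_)
open import Algebra.Bundles using (CommutativeRing)
open import Data.Nat as ℕ using (ℕ; zero; suc)
open import Data.Nat using (_!)
open import Data.Integer as ℤ using (ℤ; +_; -[1+_])
open import Data.Vec using (Vec; []; _∷_)
open import Relation.Nullary using (¬_)

stirling1 : ℕ → ℕ → ℤ
stirling1 zero    zero    = + 1
stirling1 zero    (suc i) = + 0
stirling1 (suc n) zero    = + 0
stirling1 (suc n) (suc i) = stirling1 n i ℤ.- (+ n) ℤ.* stirling1 n (suc i)

stirling2 : ℕ → ℕ → ℕ
stirling2 zero    zero    = 1
stirling2 zero    (suc i) = 0
stirling2 (suc n) zero    = 0
stirling2 (suc n) (suc i) = suc i ℕ.* stirling2 n (suc i) ℕ.+ stirling2 n i

-- A field: a commutative ring with 0 ≠ 1 in which every nonzero element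
-- has a multiplicative inverse (the inverse function is total; its value
-- at 0 is irrelevant).
record Field (c ℓ : Level.Level) : Set (Level.suc (c ⊔ ℓ)) where
  field
    commutativeRing : CommutativeRing c ℓ
  open CommutativeRing commutativeRing public
  field
    _⁻¹       : Carrier → Carrier
    0≉1       : ¬ (0# ≈ 1#)
    ⁻¹-inverse : ∀ x → ¬ (x ≈ 0#) → x * (x ⁻¹) ≈ 1#

module FieldDefs {c ℓ} (F : Field c ℓ) where
  open Field F public

  infixl 7 _/_
  _/_ : Carrier → Carrier → Carrier
  x / y = x * (y ⁻¹)

  fromℕ : ℕ → Carrier
  fromℕ zero    = 0#
  fromℕ (suc n) = 1# + fromℕ n

  fromℤ : ℤ → Carrier
  fromℤ (+ n)      = fromℕ n
  fromℤ -[1+ n ]   = - fromℕ (suc n)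

  infixr 8 _^^_
  _^^_ : Carrier → ℕ → Carrier
  x ^^ zero  = 1#
  x ^^ suc n = x * x ^^ n

  sum0 : ℕ → (ℕ → Carrier) → Carrier
  sum0 zero    f = f 0
  sum0 (suc n) f = sum0 n f + f (suc n)

  sum1 : ℕ → (ℕ → Carrier) → Carrier
  sum1 zero    f = 0#
  sum1 (suc n) f = sum1 n f + f (suc n)

  prod : ∀ {k} → Vec Carrier k → Carrier
  prod []       = 1#
  prod (x ∷ xs) = x * prod xs

  -- la stands for the quantity l^a (l = ∏ l_i), so that l^(a+i) = la * l^i.
  -- C^{(k)}_{n,m}(a,q,L)
  𝓒 : (k : ℕ) → ℕ → ℕ → (a q : Carrier) → Vec Carrier k → (la : Carrier) → Carrier
  𝓒 k n m a q L la =
    ((a + fromℕ m) ^^ k / a ^^ k) *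
    sum0 n (λ i → fromℤ (stirling1 n i) * q ^^ (n ℕ.∸ i) * (la * prod L ^^ i)
                    / (a + fromℕ i + fromℕ m) ^^ k)

  𝓑 : (k : ℕ) → ℕ → ℕ → (a q : Carrier) → Vec Carrier k → (la : Carrier) → Carrier
  𝓑 k n m a q L la =
    ((a + fromℕ m) ^^ k / a ^^ k) *
    sum0 n (λ i → fromℕ (i ! ℕ.* stirling2 n i) * (- q) ^^ (n ℕ.∸ i) * (la * prod L ^^ i)
                    / (a + fromℕ m + fromℕ i) ^^ k)

coeffB : ℕ → ℕ → ℕ → ℕ
coeffB n i j = (i !) ℕ.* stirling2 n i ℕ.* stirling2 (i ℕ.∸ 1) (j ℕ.∸ 1)

-- Write E for the shift (E g) t = g (t + 1) and let g t = l^(a+t)/(a+m+t)^k. Up to the common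
-- prefactor (a+m)^k/a^k, 𝓒_j is (E (E − q) ⋯ (E − (j−1) q) g) 0, because Σ_t s(j,t) x^t is the
-- falling factorial, and 𝓑_n is Σ_i i!{n,i} (−q)^(n−i) g i. Stirling inversion,
-- Σ_j {p,j} q^(p−j) (E − q) ⋯ (E − j q) = (E − q)^p, collapses the sum over j on the right-hand
-- side to Σ_i i!{n,i} q^(n−i) (E (E − q)^(i−1) g) 0. This and the left-hand side, as functionals
-- of g, both obey F_{n+1}(g) = F_n(t ↦ (t+1) g (t+1) − q t g t), a consequence of
-- i!{n+1,i+1} = (i+1) (i!{n,i+1} + i!{n,i}) and summation by parts, and they agree at n = 1.

module Submission where

open import Data.Nat as ℕ using (ℕ; zero; suc; _≤_; _<_; _∸_; z≤n; s≤s; _!)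
import Data.Nat.Properties as ℕₚ
open import Data.Nat.Solver using (module +-*-Solver)
open import Data.Integer as ℤ using (ℤ; +_; -[1+_])
import Data.Integer.Properties as ℤₚ
open import Data.Maybe using (Maybe; nothing; just)
open import Data.Product using (_,_)
open import Data.Vec using (Vec)
open import Data.Vec.Relation.Unary.All using (All)
open import Relation.Nullary using (¬_; yes; no)
open import Relation.Binary.PropositionalEquality as ≡ using (_≡_)
import Algebra.Properties.Ring as RingProperties
import Algebra.Solver.Ring as RingSolver
import Algebra.Solver.Ring.AlmostCommutativeRing as ACR
open import Defs

module Arithmetic {c ℓ} (F : Field c ℓ) where
  open FieldDefs F
  open RingProperties ring
  open import Relation.Binary.Reasoning.Setoid setoid

  fromℕ-+ : ∀ m n → fromℕ (m ℕ.+ n) ≈ fromℕ m + fromℕ n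
  fromℕ-+ zero    n = sym (+-identityˡ _)
  fromℕ-+ (suc m) n = trans (+-congˡ (fromℕ-+ m n)) (sym (+-assoc _ _ _))

  fromℕ-* : ∀ m n → fromℕ (m ℕ.* n) ≈ fromℕ m * fromℕ n
  fromℕ-* zero    n = sym (zeroˡ _)
  fromℕ-* (suc m) n = begin
    fromℕ (n ℕ.+ m ℕ.* n)                ≈⟨ fromℕ-+ n (m ℕ.* n) ⟩
    fromℕ n + fromℕ (m ℕ.* n)            ≈⟨ +-cong (sym (*-identityˡ _)) (fromℕ-* m n) ⟩
    1# * fromℕ n + fromℕ m * fromℕ n     ≈⟨ distribʳ _ _ _ ⟨
    (1# + fromℕ m) * fromℕ n             ∎

  fromℤ-⊖ : ∀ m n → fromℤ (m ℤ.⊖ n) ≈ fromℕ m - fromℕ n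
  fromℤ-⊖ m       zero    = sym (trans (+-congˡ -0#≈0#) (+-identityʳ _))
  fromℤ-⊖ zero    (suc n) = sym (+-identityˡ _)
  fromℤ-⊖ (suc m) (suc n) rewrite ℤₚ.[1+m]⊖[1+n]≡m⊖n m n = begin
    fromℤ (m ℤ.⊖ n)                    ≈⟨ fromℤ-⊖ m n ⟩
    fromℕ m - fromℕ n                  ≈⟨ +-congˡ (sym (+-identityˡ _)) ⟩
    fromℕ m + (0# - fromℕ n)           ≈⟨ +-congˡ (+-congʳ (sym (-‿inverseʳ 1#))) ⟩
    fromℕ m + ((1# - 1#) - fromℕ n)    ≈⟨ +-congˡ (+-assoc _ _ _) ⟩
    fromℕ m + (1# + (- 1# - fromℕ n))  ≈⟨ +-assoc _ _ _ ⟨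
    (fromℕ m + 1#) + (- 1# - fromℕ n)  ≈⟨ +-cong (+-comm _ _) (-‿+-comm 1# (fromℕ n)) ⟩
    (1# + fromℕ m) - (1# + fromℕ n)    ∎

  fromℤ-+ : ∀ x y → fromℤ (x ℤ.+ y) ≈ fromℤ x + fromℤ y
  fromℤ-+ (+ m)    (+ n)    = fromℕ-+ m n
  fromℤ-+ (+ m)    -[1+ n ] = fromℤ-⊖ m (suc n)
  fromℤ-+ -[1+ m ] (+ n)    = trans (fromℤ-⊖ n (suc m)) (+-comm _ _)
  fromℤ-+ -[1+ m ] -[1+ n ] = begin
    - (1# + (1# + fromℕ (m ℕ.+ n)))          ≈⟨ -‿cong (+-congˡ (+-congˡ (fromℕ-+ m n))) ⟩
    - (1# + (1# + (fromℕ m + fromℕ n)))      ≈⟨ -‿cong (+-congˡ (+-assoc _ _ _)) ⟨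
    - (1# + ((1# + fromℕ m) + fromℕ n))      ≈⟨ -‿cong (+-congˡ (+-congʳ (+-comm _ _))) ⟩
    - (1# + ((fromℕ m + 1#) + fromℕ n))      ≈⟨ -‿cong (+-congˡ (+-assoc _ _ _)) ⟩
    - (1# + (fromℕ m + (1# + fromℕ n)))      ≈⟨ -‿cong (+-assoc _ _ _) ⟨
    - ((1# + fromℕ m) + (1# + fromℕ n))      ≈⟨ -‿+-comm _ _ ⟨
    - (1# + fromℕ m) - (1# + fromℕ n)        ∎

  fromℤ-neg : ∀ x → fromℤ (ℤ.- x) ≈ - fromℤ x
  fromℤ-neg (+ zero)  = sym -0#≈0#
  fromℤ-neg (+ suc n) = refl
  fromℤ-neg -[1+ n ]  = sym (-‿involutive _)

  fromℤ-+* : ∀ m y → fromℤ (+ m ℤ.* y) ≈ fromℕ m * fromℤ y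
  fromℤ-+* zero    y = sym (zeroˡ _)
  fromℤ-+* (suc m) y = begin
    fromℤ (+ suc m ℤ.* y)                ≡⟨ ≡.cong fromℤ (ℤₚ.suc-* (+ m) y) ⟩
    fromℤ (y ℤ.+ + m ℤ.* y)              ≈⟨ fromℤ-+ y (+ m ℤ.* y) ⟩
    fromℤ y + fromℤ (+ m ℤ.* y)          ≈⟨ +-cong (sym (*-identityˡ _)) (fromℤ-+* m y) ⟩
    1# * fromℤ y + fromℕ m * fromℤ y     ≈⟨ distribʳ _ _ _ ⟨
    (1# + fromℕ m) * fromℤ y             ∎

  fromℤ-* : ∀ x y → fromℤ (x ℤ.* y) ≈ fromℤ x * fromℤ y
  fromℤ-* (+ m)    y = fromℤ-+* m y
  fromℤ-* -[1+ m ] y = begin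
    fromℤ (-[1+ m ] ℤ.* y)            ≡⟨ ≡.cong fromℤ (ℤₚ.neg-distribˡ-* (+ suc m) y) ⟨
    fromℤ (ℤ.- (+ suc m ℤ.* y))       ≈⟨ fromℤ-neg (+ suc m ℤ.* y) ⟩
    - fromℤ (+ suc m ℤ.* y)           ≈⟨ -‿cong (fromℤ-+* (suc m) y) ⟩
    - (fromℕ (suc m) * fromℤ y)       ≈⟨ -‿distribˡ-* _ _ ⟩
    - fromℕ (suc m) * fromℤ y         ∎

  -- Coefficient map of the ring solver. It agrees with fromℤ, but sends + 1 to 1# on
  -- the nose, so that a solver constant con (+ 1) matches the 1# of fromℕ (suc n) = 1# + fromℕ n.
  fromℕ′ : ℕ → Carrier
  fromℕ′ zero          = 0#
  fromℕ′ (suc zero)    = 1#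
  fromℕ′ (suc (suc n)) = 1# + fromℕ′ (suc n)

  fromℤ′ : ℤ → Carrier
  fromℤ′ (+ n)    = fromℕ′ n
  fromℤ′ -[1+ n ] = - fromℕ′ (suc n)

  fromℕ′≈fromℕ : ∀ n → fromℕ′ n ≈ fromℕ n
  fromℕ′≈fromℕ zero          = refl
  fromℕ′≈fromℕ (suc zero)    = sym (+-identityʳ _)
  fromℕ′≈fromℕ (suc (suc n)) = +-congˡ (fromℕ′≈fromℕ (suc n))

  fromℤ′≈fromℤ : ∀ x → fromℤ′ x ≈ fromℤ x
  fromℤ′≈fromℤ (+ n)    = fromℕ′≈fromℕ n
  fromℤ′≈fromℤ -[1+ n ] = -‿cong (fromℕ′≈fromℕ (suc n))

  fromℤ′-homomorphism : ℤ.+-*-rawRing ACR.-Raw-AlmostCommutative⟶ ACR.fromCommutativeRing commutativeRing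
  fromℤ′-homomorphism = record
    { ⟦_⟧    = fromℤ′
    ; +-homo = λ x y → transport (ℤ._+_ x y) (fromℤ-+ x y) (+-cong (fromℤ′≈fromℤ x) (fromℤ′≈fromℤ y))
    ; *-homo = λ x y → transport (ℤ._*_ x y) (fromℤ-* x y) (*-cong (fromℤ′≈fromℤ x) (fromℤ′≈fromℤ y))
    ; -‿homo = λ x → transport (ℤ.- x) (fromℤ-neg x) (-‿cong (fromℤ′≈fromℤ x))
    ; 0-homo = refl
    ; 1-homo = refl
    }
    where
    transport : ∀ z {u v} → fromℤ z ≈ u → v ≈ u → fromℤ′ z ≈ v
    transport z p q = trans (fromℤ′≈fromℤ z) (trans p (sym q))

  coefficients-equal? : ∀ x y → Maybe (fromℤ′ x ≈ fromℤ′ y)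
  coefficients-equal? x y with x ℤ.≟ y
  ... | yes ≡.refl = just refl
  ... | no _       = nothing

  open RingSolver ℤ.+-*-rawRing (ACR.fromCommutativeRing commutativeRing)
    fromℤ′-homomorphism coefficients-equal? public

  sum0-cong : ∀ n {f g : ℕ → Carrier} → (∀ i → i ≤ n → f i ≈ g i) → sum0 n f ≈ sum0 n g
  sum0-cong zero    f≈g = f≈g 0 z≤n
  sum0-cong (suc n) f≈g =
    +-cong (sum0-cong n (λ i i≤n → f≈g i (ℕₚ.m≤n⇒m≤1+n i≤n))) (f≈g (suc n) ℕₚ.≤-refl)

  sum1-cong : ∀ n {f g : ℕ → Carrier} → (∀ i → suc i ≤ n → f (suc i) ≈ g (suc i)) →
              sum1 n f ≈ sum1 n g
  sum1-cong zero    f≈g = refl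
  sum1-cong (suc n) f≈g =
    +-cong (sum1-cong n (λ i i<n → f≈g i (ℕₚ.m≤n⇒m≤1+n i<n))) (f≈g n ℕₚ.≤-refl)

  sum0-suc : ∀ n (f : ℕ → Carrier) → sum0 (suc n) f ≈ f 0 + sum0 n (λ i → f (suc i))
  sum0-suc zero    f = refl
  sum0-suc (suc n) f = trans (+-congʳ (sum0-suc n f)) (+-assoc _ _ _)

  sum1-suc : ∀ n (f : ℕ → Carrier) → sum1 (suc n) f ≈ sum0 n (λ i → f (suc i))
  sum1-suc zero    f = +-identityˡ _
  sum1-suc (suc n) f = +-congʳ (sum1-suc n f)

  sum0≈head+sum1 : ∀ n (f : ℕ → Carrier) → sum0 n f ≈ f 0 + sum1 n f
  sum0≈head+sum1 zero    f = sym (+-identityʳ _)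
  sum0≈head+sum1 (suc n) f = trans (+-congʳ (sum0≈head+sum1 n f)) (+-assoc _ _ _)

  private
    interchange : ∀ a b c d → (a + b) + (c + d) ≈ (a + c) + (b + d)
    interchange = solve 4 (λ a b c d → (a :+ b) :+ (c :+ d) := (a :+ c) :+ (b :+ d)) refl

  sum0-+ : ∀ n (f g : ℕ → Carrier) → sum0 n (λ i → f i + g i) ≈ sum0 n f + sum0 n g
  sum0-+ zero    f g = refl
  sum0-+ (suc n) f g = trans (+-congʳ (sum0-+ n f g)) (interchange _ _ _ _)

  sum1-+ : ∀ n (f g : ℕ → Carrier) → sum1 n (λ i → f i + g i) ≈ sum1 n f + sum1 n g
  sum1-+ zero    f g = sym (+-identityʳ _)
  sum1-+ (suc n) f g = trans (+-congʳ (sum1-+ n f g)) (interchange _ _ _ _)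

  sum0-distribˡ : ∀ n x (f : ℕ → Carrier) → x * sum0 n f ≈ sum0 n (λ i → x * f i)
  sum0-distribˡ zero    x f = refl
  sum0-distribˡ (suc n) x f = trans (distribˡ _ _ _) (+-congʳ (sum0-distribˡ n x f))

  sum1-distribˡ : ∀ n x (f : ℕ → Carrier) → x * sum1 n f ≈ sum1 n (λ i → x * f i)
  sum1-distribˡ zero    x f = zeroʳ _
  sum1-distribˡ (suc n) x f = trans (distribˡ _ _ _) (+-congʳ (sum1-distribˡ n x f))

  sum1-distribʳ : ∀ n x (f : ℕ → Carrier) → sum1 n f * x ≈ sum1 n (λ i → f i * x)
  sum1-distribʳ n x f =
    trans (*-comm _ _) (trans (sum1-distribˡ n x f) (sum1-cong n (λ _ _ → *-comm _ _)))

  -‿sum0 : ∀ n (f : ℕ → Carrier) → - sum0 n f ≈ sum0 n (λ i → - f i)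
  -‿sum0 zero    f = refl
  -‿sum0 (suc n) f = trans (sym (-‿+-comm _ _)) (+-congʳ (-‿sum0 n f))

  sum0-vanishing-tail : ∀ p d (f : ℕ → Carrier) → (∀ i → p < i → f i ≈ 0#) →
                        sum0 (p ℕ.+ d) f ≈ sum0 p f
  sum0-vanishing-tail p zero    f tail≈0 rewrite ℕₚ.+-identityʳ p = refl
  sum0-vanishing-tail p (suc d) f tail≈0 rewrite ℕₚ.+-suc p d =
    trans (+-cong (sum0-vanishing-tail p d f tail≈0) (tail≈0 (suc (p ℕ.+ d)) (s≤s (ℕₚ.m≤m+n p d))))
          (+-identityʳ _)

  sum1-zero : ∀ n → sum1 n (λ _ → 0#) ≈ 0#
  sum1-zero zero    = refl
  sum1-zero (suc n) = trans (+-identityʳ _) (sum1-zero n)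

  sum1-comm : ∀ m n (h : ℕ → ℕ → Carrier) →
              sum1 m (λ j → sum1 n (λ i → h j i)) ≈ sum1 n (λ i → sum1 m (λ j → h j i))
  sum1-comm zero    n h = sym (sum1-zero n)
  sum1-comm (suc m) n h = begin
    sum1 m (λ j → sum1 n (h j)) + sum1 n (h (suc m))            ≈⟨ +-congʳ (sum1-comm m n h) ⟩
    sum1 n (λ i → sum1 m (λ j → h j i)) + sum1 n (h (suc m))    ≈⟨ sum1-+ n _ _ ⟨
    sum1 n (λ i → sum1 (suc m) (λ j → h j i))                   ∎

  sum0-telescope : ∀ n (χ : ℕ → Carrier) → sum0 n (λ u → χ (suc u) - χ u) ≈ χ (suc n) - χ 0
  sum0-telescope zero    χ = refl
  sum0-telescope (suc n) χ = trans (+-congʳ (sum0-telescope n χ))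
    (solve 3 (λ a b c → (b :- a) :+ (c :- b) := c :- a) refl _ _ _)

  sum0-by-parts : ∀ n (f g χ : ℕ → Carrier) → (∀ u → u ≤ n → f u ≈ g u + (χ (suc u) - χ u)) →
                  χ 0 ≈ 0# → χ (suc n) ≈ 0# → sum0 n f ≈ sum0 n g
  sum0-by-parts n f g χ f≈g+dχ χ0≈0 χn≈0 = begin
    sum0 n f                                          ≈⟨ sum0-cong n f≈g+dχ ⟩
    sum0 n (λ u → g u + (χ (suc u) - χ u))            ≈⟨ sum0-+ n _ _ ⟩
    sum0 n g + sum0 n (λ u → χ (suc u) - χ u)         ≈⟨ +-congˡ (sum0-telescope n χ) ⟩
    sum0 n g + (χ (suc n) - χ 0)                      ≈⟨ +-congˡ (+-cong χn≈0 (-‿cong χ0≈0)) ⟩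
    sum0 n g + (0# - 0#)                              ≈⟨ +-congˡ (-‿inverseʳ 0#) ⟩
    sum0 n g + 0#                                     ≈⟨ +-identityʳ _ ⟩
    sum0 n g                                          ∎

  ^^-+ : ∀ x m n → x ^^ (m ℕ.+ n) ≈ x ^^ m * x ^^ n
  ^^-+ x zero    n = sym (*-identityˡ _)
  ^^-+ x (suc m) n = trans (*-congˡ (^^-+ x m n)) (sym (*-assoc _ _ _))

  ^^-suc-∸ : ∀ x {m n} → n ≤ m → x ^^ (suc m ∸ n) ≈ x * x ^^ (m ∸ n)
  ^^-suc-∸ x {n = n} n≤m rewrite ℕₚ.+-∸-assoc 1 n≤m = refl

  ^^-cong : ∀ {x y} n → x ≈ y → x ^^ n ≈ y ^^ n
  ^^-cong zero    x≈y = refl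
  ^^-cong (suc n) x≈y = *-cong x≈y (^^-cong n x≈y)

  x*0*y≈0 : ∀ x y → x * 0# * y ≈ 0#
  x*0*y≈0 x y = trans (*-congʳ (zeroʳ x)) (zeroˡ y)

  0*x*y≈0 : ∀ x y → 0# * x * y ≈ 0#
  0*x*y≈0 x y = trans (*-congʳ (zeroˡ x)) (zeroˡ y)

  ⁻¹-cong : ∀ {x y} → ¬ (y ≈ 0#) → x ≈ y → x ⁻¹ ≈ y ⁻¹
  ⁻¹-cong {x} {y} y≉0 x≈y = begin
    x ⁻¹                ≈⟨ *-identityʳ _ ⟨
    x ⁻¹ * 1#           ≈⟨ *-congˡ (⁻¹-inverse y y≉0) ⟨
    x ⁻¹ * (y * y ⁻¹)   ≈⟨ *-assoc _ _ _ ⟨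
    x ⁻¹ * y * y ⁻¹     ≈⟨ *-congʳ (*-congˡ x≈y) ⟨
    x ⁻¹ * x * y ⁻¹     ≈⟨ *-congʳ (trans (*-comm _ _) (⁻¹-inverse x (λ x≈0 → y≉0 (trans (sym x≈y) x≈0)))) ⟩
    1# * y ⁻¹           ≈⟨ *-identityˡ _ ⟩
    y ⁻¹                ∎

  ^^-nonzero : ∀ {x} n → ¬ (x ≈ 0#) → ¬ (x ^^ n ≈ 0#)
  ^^-nonzero zero    x≉0 1≈0 = 0≉1 (sym 1≈0)
  ^^-nonzero {x} (suc n) x≉0 xⁿ⁺¹≈0 = ^^-nonzero n x≉0 (begin
    x ^^ n                  ≈⟨ *-identityˡ _ ⟨
    1# * x ^^ n             ≈⟨ *-congʳ (trans (*-comm _ _) (⁻¹-inverse x x≉0)) ⟨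
    x ⁻¹ * x * x ^^ n       ≈⟨ *-assoc _ _ _ ⟩
    x ⁻¹ * (x * x ^^ n)     ≈⟨ *-congˡ xⁿ⁺¹≈0 ⟩
    x ⁻¹ * 0#               ≈⟨ zeroʳ _ ⟩
    0#                      ∎)

stirling1-vanishes : ∀ {j t} → j < t → stirling1 j t ≡ + 0
stirling1-vanishes {zero}  {suc t} _ = ≡.refl
stirling1-vanishes {suc j} {suc t} (s≤s j<t)
  rewrite stirling1-vanishes (ℕₚ.m≤n⇒m≤1+n j<t) | stirling1-vanishes j<t | ℤₚ.*-zeroʳ (+ j) = ≡.refl

stirling2-vanishes : ∀ {p j} → p < j → stirling2 p j ≡ 0
stirling2-vanishes {zero}  {suc j} _ = ≡.refl
stirling2-vanishes {suc p} {suc j} (s≤s p<j)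
  rewrite stirling2-vanishes (ℕₚ.m≤n⇒m≤1+n p<j) | stirling2-vanishes p<j =
    ≡.trans (ℕₚ.+-identityʳ _) (ℕₚ.*-zeroʳ j)

surjections : ℕ → ℕ → ℕ
surjections n i = i ! ℕ.* stirling2 n i

surjections-vanishes : ∀ {n i} → n < i → surjections n i ≡ 0
surjections-vanishes {i = i} n<i rewrite stirling2-vanishes n<i = ℕₚ.*-zeroʳ (i !)

surjections-suc : ∀ n i →
  surjections (suc n) (suc i) ≡ suc i ℕ.* (surjections n (suc i) ℕ.+ surjections n i)
surjections-suc n i =
  solve 4 (λ s f x y → (s :* f) :* (s :* x :+ y) := s :* ((s :* f) :* x :+ f :* y))
    ≡.refl (suc i) (i !) (stirling2 n (suc i)) (stirling2 n i)
  where open +-*-Solver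

module Fubini {c ℓ} (F : Field c ℓ) where
  open FieldDefs F
  open Arithmetic F
  open import Relation.Binary.Reasoning.Setoid setoid

  fubini : ℕ → Carrier → (ℕ → Carrier) → Carrier
  fubini n r φ = sum1 n (λ i → fromℕ (surjections n i) * r ^^ (n ∸ i) * φ i)

  fubiniStep : Carrier → (ℕ → Carrier) → ℕ → Carrier
  fubiniStep r φ i = fromℕ (suc i) * φ (suc i) + r * fromℕ i * φ i

  fubini-cong : ∀ n r {φ ψ : ℕ → Carrier} → (∀ i → suc i ≤ n → φ (suc i) ≈ ψ (suc i)) →
                fubini n r φ ≈ fubini n r ψ
  fubini-cong n r φ≈ψ = sum1-cong n (λ i i<n → *-congˡ (φ≈ψ i i<n))

  fubini-suc : ∀ n r φ → fubini (suc (suc n)) r φ ≈ fubini (suc n) r (fubiniStep r φ)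
  fubini-suc n r φ = begin
    fubini (suc n′) r φ                     ≈⟨ sum1-suc n′ _ ⟩
    sum0 n′ (λ u → A (suc n′) (suc u) * r ^^ (n′ ∸ u) * φ (suc u))
                                            ≈⟨ sum0-by-parts n′ _ term χ split χ0≈0 χn≈0 ⟩
    sum0 n′ term                            ≈⟨ sum0≈head+sum1 n′ term ⟩
    term 0 + sum1 n′ term                   ≈⟨ +-congʳ (0*x*y≈0 _ _) ⟩
    0# + sum1 n′ term                       ≈⟨ +-identityˡ _ ⟩
    fubini n′ r (fubiniStep r φ)            ∎
    where
    n′ = suc n
    A : ℕ → ℕ → Carrier
    A n i = fromℕ (surjections n i)
    term : ℕ → Carrier
    term u = A n′ u * r ^^ (n′ ∸ u) * fubiniStep r φ u
    χ : ℕ → Carrier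
    χ v = r ^^ (suc n′ ∸ v) * fromℕ v * A n′ v * φ v
    χ0≈0 : χ 0 ≈ 0#
    χ0≈0 = trans (*-congʳ (x*0*y≈0 _ _)) (zeroˡ _)
    χn≈0 : χ (suc n′) ≈ 0#
    χn≈0 = trans (*-congʳ (*-congˡ (reflexive (≡.cong fromℕ (surjections-vanishes (ℕₚ.n<1+n n′))))))
                 (x*0*y≈0 _ _)
    A-suc : ∀ u → A (suc n′) (suc u) ≈ fromℕ (suc u) * (A n′ (suc u) + A n′ u)
    A-suc u = begin
      A (suc n′) (suc u)  ≡⟨ ≡.cong fromℕ (surjections-suc n′ u) ⟩
      fromℕ (suc u ℕ.* (surjections n′ (suc u) ℕ.+ surjections n′ u))
                          ≈⟨ fromℕ-* (suc u) (surjections n′ (suc u) ℕ.+ surjections n′ u) ⟩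
      fromℕ (suc u) * fromℕ (surjections n′ (suc u) ℕ.+ surjections n′ u)
                          ≈⟨ *-congˡ (fromℕ-+ (surjections n′ (suc u)) (surjections n′ u)) ⟩
      fromℕ (suc u) * (A n′ (suc u) + A n′ u) ∎
    split : ∀ u → u ≤ n′ → A (suc n′) (suc u) * r ^^ (n′ ∸ u) * φ (suc u) ≈ term u + (χ (suc u) - χ u)
    split u u≤n′ = begin
      A (suc n′) (suc u) * r ^^ (n′ ∸ u) * φ (suc u)    ≈⟨ *-congʳ (*-congʳ (A-suc u)) ⟩
      _  ≈⟨ solve 7 (λ R r a A₁ A₀ φ₁ φ₀ →
              (con (+ 1) :+ a) :* (A₁ :+ A₀) :* R :* φ₁
              := A₀ :* R :* ((con (+ 1) :+ a) :* φ₁ :+ r :* a :* φ₀)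
                 :+ (R :* (con (+ 1) :+ a) :* A₁ :* φ₁ :- (r :* R) :* a :* A₀ :* φ₀))
              refl (r ^^ (n′ ∸ u)) r (fromℕ u) (A n′ (suc u)) (A n′ u) (φ (suc u)) (φ u) ⟩
      _  ≈⟨ +-congˡ (+-congˡ (-‿cong (*-congʳ (*-congʳ (*-congʳ (sym (^^-suc-∸ r u≤n′))))))) ⟩
      term u + (χ (suc u) - χ u)                        ∎

module StirlingTransform {c ℓ} (F : Field c ℓ) (q : FieldDefs.Carrier F) where
  open FieldDefs F
  open RingProperties ring
  open Arithmetic F
  open Fubini F
  open import Relation.Binary.Reasoning.Setoid setoid

  s₁ : ℕ → ℕ → Carrier
  s₁ j t = fromℤ (stirling1 j t)

  S₂ : ℕ → ℕ → Carrier
  S₂ p j = fromℕ (stirling2 p j)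

  shift : (ℕ → Carrier) → ℕ → Carrier
  shift g t = g (suc t)

  -- With E the shift operator, C j g = (E (E − q) ⋯ (E − (j − 1) q) g) 0
  -- and Δ p g = ((E − q) ^ p g) 1.
  C : ℕ → (ℕ → Carrier) → Carrier
  C j g = sum0 j (λ t → s₁ j t * q ^^ (j ∸ t) * g t)

  Δ : ℕ → (ℕ → Carrier) → Carrier
  Δ zero    g = g 1
  Δ (suc p) g = Δ p (shift g) - q * Δ p g

  s₁-vanishes : ∀ {j t} → j < t → s₁ j t ≈ 0#
  s₁-vanishes j<t = reflexive (≡.cong fromℤ (stirling1-vanishes j<t))

  S₂-vanishes : ∀ {p j} → p < j → S₂ p j ≈ 0#
  S₂-vanishes p<j = reflexive (≡.cong fromℕ (stirling2-vanishes p<j))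

  s₁-suc : ∀ j t → s₁ (suc j) (suc t) ≈ s₁ j t - fromℕ j * s₁ j (suc t)
  s₁-suc j t = begin
    fromℤ (stirling1 j t ℤ.- + j ℤ.* stirling1 j (suc t))  ≈⟨ fromℤ-+ (stirling1 j t) _ ⟩
    s₁ j t + fromℤ (ℤ.- (+ j ℤ.* stirling1 j (suc t)))     ≈⟨ +-congˡ (fromℤ-neg (+ j ℤ.* stirling1 j (suc t))) ⟩
    s₁ j t - fromℤ (+ j ℤ.* stirling1 j (suc t))           ≈⟨ +-congˡ (-‿cong (fromℤ-+* j (stirling1 j (suc t)))) ⟩
    s₁ j t - fromℕ j * s₁ j (suc t)                        ∎

  S₂-suc : ∀ p j → S₂ (suc p) (suc j) ≈ fromℕ (suc j) * S₂ p (suc j) + S₂ p j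
  S₂-suc p j = trans (fromℕ-+ (suc j ℕ.* stirling2 p (suc j)) (stirling2 p j))
                     (+-congʳ (fromℕ-* (suc j) (stirling2 p (suc j))))

  C-suc-reindex : ∀ j g → C (suc j) g ≈ sum0 j (λ u → s₁ (suc j) (suc u) * q ^^ (j ∸ u) * g (suc u))
  C-suc-reindex j g = trans (sum0-suc j _) (trans (+-congʳ (0*x*y≈0 _ _)) (+-identityˡ _))

  C-suc : ∀ j g → C (suc j) g ≈ C j (shift g) - q * fromℕ j * C j g
  C-suc j g = begin
    C (suc j) g                                          ≈⟨ C-suc-reindex j g ⟩
    sum0 j (λ u → s₁ (suc j) (suc u) * q ^^ (j ∸ u) * g (suc u))
                                                         ≈⟨ sum0-cong j (λ u _ → split u) ⟩
    sum0 j (λ u → s₁ j u * q ^^ (j ∸ u) * g (suc u) + - (fromℕ j * tail j u))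
                                                         ≈⟨ sum0-+ j _ _ ⟩
    C j (shift g) + sum0 j (λ u → - (fromℕ j * tail j u))
                                                         ≈⟨ +-congˡ (-‿sum0 j _) ⟨
    C j (shift g) - sum0 j (λ u → fromℕ j * tail j u)    ≈⟨ +-congˡ (-‿cong (sum0-distribˡ j (fromℕ j) (tail j))) ⟨
    C j (shift g) - fromℕ j * sum0 j (tail j)            ≈⟨ +-congˡ (-‿cong (weighted-tail j)) ⟩
    C j (shift g) - q * fromℕ j * C j g                  ∎
    where
    tail : ℕ → ℕ → Carrier
    tail j u = s₁ j (suc u) * q ^^ (j ∸ u) * g (suc u)
    split : ∀ u → s₁ (suc j) (suc u) * q ^^ (j ∸ u) * g (suc u) ≈
                  s₁ j u * q ^^ (j ∸ u) * g (suc u) + - (fromℕ j * tail j u)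
    split u = trans (*-congʳ (*-congʳ (s₁-suc j u)))
      (solve 5 (λ a n b Q G → (a :- n :* b) :* Q :* G := a :* Q :* G :+ :- (n :* (b :* Q :* G)))
        refl _ _ _ _ _)
    -- The sum of tail j is C j g without its t = 0 term, times q; that term vanishes unless j = 0.
    weighted-tail : ∀ j → fromℕ j * sum0 j (tail j) ≈ q * fromℕ j * C j g
    weighted-tail zero    = trans (zeroˡ _) (sym (trans (*-congʳ (zeroʳ q)) (zeroˡ _)))
    weighted-tail (suc j) = begin
      fromℕ (suc j) * (sum0 j (tail (suc j)) + tail (suc j) (suc j))
                  ≈⟨ *-congˡ (+-congˡ (*-congʳ (*-congʳ (s₁-vanishes (ℕₚ.n<1+n (suc j)))))) ⟩
      fromℕ (suc j) * (sum0 j (tail (suc j)) + 0# * _ * _)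
                  ≈⟨ *-congˡ (trans (+-congˡ (0*x*y≈0 _ _)) (+-identityʳ _)) ⟩
      fromℕ (suc j) * sum0 j (tail (suc j))
                  ≈⟨ *-congˡ (sum0-cong j (λ u u≤j → trans (*-congʳ (*-congˡ (^^-suc-∸ q u≤j)))
                       (solve 4 (λ a q b c → a :* (q :* b) :* c := q :* (a :* b :* c)) refl _ _ _ _))) ⟩
      fromℕ (suc j) * sum0 j (λ u → q * (s₁ (suc j) (suc u) * q ^^ (j ∸ u) * g (suc u)))
                  ≈⟨ *-congˡ (sum0-distribˡ j q _) ⟨
      fromℕ (suc j) * (q * sum0 j (λ u → s₁ (suc j) (suc u) * q ^^ (j ∸ u) * g (suc u)))
                  ≈⟨ *-congˡ (*-congˡ (C-suc-reindex j g)) ⟨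
      fromℕ (suc j) * (q * C (suc j) g)
                  ≈⟨ solve 3 (λ n q c → n :* (q :* c) := q :* n :* c) refl _ _ _ ⟩
      q * fromℕ (suc j) * C (suc j) g ∎

  Δ-cong : ∀ p {f h : ℕ → Carrier} → (∀ t → f t ≈ h t) → Δ p f ≈ Δ p h
  Δ-cong zero    f≈h = f≈h 1
  Δ-cong (suc p) f≈h = +-cong (Δ-cong p (λ t → f≈h (suc t))) (-‿cong (*-congˡ (Δ-cong p f≈h)))

  Δ-+ : ∀ p (f h : ℕ → Carrier) → Δ p (λ t → f t + h t) ≈ Δ p f + Δ p h
  Δ-+ zero    f h = refl
  Δ-+ (suc p) f h = trans (+-cong (Δ-+ p _ _) (-‿cong (*-congˡ (Δ-+ p f h))))
    (solve 5 (λ q a b c d → (a :+ b) :- q :* (c :+ d) := (a :- q :* c) :+ (b :- q :* d)) refl q _ _ _ _)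

  Δ-*ˡ : ∀ p x (f : ℕ → Carrier) → Δ p (λ t → x * f t) ≈ x * Δ p f
  Δ-*ˡ zero    x f = refl
  Δ-*ˡ (suc p) x f = trans (+-cong (Δ-*ˡ p x _) (-‿cong (*-congˡ (Δ-*ˡ p x f))))
    (solve 4 (λ q x a c → x :* a :- q :* (x :* c) := x :* (a :- q :* c)) refl q x _ _)

  Δ-weight : ∀ p g → Δ (suc p) (λ t → fromℕ t * g t) ≈
                     fromℕ (suc (suc p)) * Δ (suc p) g + q * fromℕ (suc p) * Δ p g
  Δ-weight zero    g =
    solve 3 (λ q x y → (con (+ 1) :+ (con (+ 1) :+ con (+ 0))) :* y :- q :* ((con (+ 1) :+ con (+ 0)) :* x)
                   := (con (+ 1) :+ (con (+ 1) :+ con (+ 0))) :* (y :- q :* x) :+ q :* (con (+ 1) :+ con (+ 0)) :* x)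
      refl q (g 1) (g 2)
  Δ-weight (suc p) g = begin
    Δ (suc p) (λ t → fromℕ (suc t) * g (suc t)) - q * Δ (suc p) (λ t → fromℕ t * g t)
        ≈⟨ +-cong shifted (-‿cong (*-congˡ (Δ-weight p g))) ⟩
    _   ≈⟨ solve 5 (λ q a u v z →
             ((con (+ 1) :+ a) :* u :+ q :* a :* v :+ u) :- q :* ((con (+ 1) :+ a) :* (v :- q :* z) :+ q :* a :* z)
             := (con (+ 1) :+ (con (+ 1) :+ a)) :* (u :- q :* (v :- q :* z)) :+ q :* (con (+ 1) :+ a) :* (v :- q :* z))
             refl q (fromℕ (suc p)) (Δ (suc p) (shift g)) (Δ p (shift g)) (Δ p g) ⟩
    fromℕ (suc (suc (suc p))) * Δ (suc (suc p)) g + q * fromℕ (suc (suc p)) * Δ (suc p) g ∎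
    where
    shifted : Δ (suc p) (λ t → fromℕ (suc t) * g (suc t)) ≈
              fromℕ (suc (suc p)) * Δ (suc p) (shift g) + q * fromℕ (suc p) * Δ p (shift g) + Δ (suc p) (shift g)
    shifted = begin
      Δ (suc p) (λ t → fromℕ (suc t) * g (suc t))
          ≈⟨ Δ-cong (suc p) (λ t → solve 2 (λ a b → (con (+ 1) :+ a) :* b := a :* b :+ b) refl (fromℕ t) (g (suc t))) ⟩
      Δ (suc p) (λ t → fromℕ t * g (suc t) + g (suc t))
          ≈⟨ Δ-+ (suc p) _ _ ⟩
      Δ (suc p) (λ t → fromℕ t * g (suc t)) + Δ (suc p) (shift g)
          ≈⟨ +-congʳ (Δ-weight p (shift g)) ⟩
      fromℕ (suc (suc p)) * Δ (suc p) (shift g) + q * fromℕ (suc p) * Δ p (shift g) + Δ (suc p) (shift g) ∎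

  Δ-fubiniStep : ∀ p g → Δ p (fubiniStep (- q) g) ≈ fubiniStep q (λ i → Δ (i ∸ 1) g) (suc p)
  Δ-fubiniStep p g = begin
    Δ p (fubiniStep (- q) g)
        ≈⟨ Δ-cong p (λ t → +-congˡ (*-assoc _ _ _)) ⟩
    Δ p (λ t → fromℕ (suc t) * g (suc t) + - q * (fromℕ t * g t))
        ≈⟨ Δ-+ p _ _ ⟩
    Δ p (λ t → fromℕ (suc t) * g (suc t)) + Δ p (λ t → - q * (fromℕ t * g t))
        ≈⟨ +-congˡ (trans (Δ-*ˡ p (- q) _) (sym (-‿distribˡ-* q _))) ⟩
    Δ (suc p) (λ t → fromℕ t * g t) ≈⟨ Δ-weight p g ⟩
    fubiniStep q (λ i → Δ (i ∸ 1) g) (suc p) ∎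

  inversionSum : ℕ → (ℕ → Carrier) → Carrier
  inversionSum p g = sum0 p (λ j → q ^^ (p ∸ j) * S₂ p j * C (suc j) g)

  inversionSum-suc : ∀ p g → inversionSum (suc p) g ≈ inversionSum p (shift g) - q * inversionSum p g
  inversionSum-suc p g = begin
    inversionSum (suc p) g              ≈⟨ sum0-suc p _ ⟩
    q ^^ suc p * 0# * C 1 g + sum0 p f  ≈⟨ +-congʳ (x*0*y≈0 _ _) ⟩
    0# + sum0 p f                       ≈⟨ +-identityˡ _ ⟩
    sum0 p f                            ≈⟨ sum0-by-parts p f term χ split χ0≈0 χp≈0 ⟩
    sum0 p term                         ≈⟨ sum0-+ p _ _ ⟩
    inversionSum p (shift g) + sum0 p (λ u → - (q * (q ^^ (p ∸ u) * S₂ p u * C (suc u) g)))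
                                        ≈⟨ +-congˡ (-‿sum0 p _) ⟨
    inversionSum p (shift g) - sum0 p (λ u → q * (q ^^ (p ∸ u) * S₂ p u * C (suc u) g))
                                        ≈⟨ +-congˡ (-‿cong (sum0-distribˡ p q _)) ⟨
    inversionSum p (shift g) - q * inversionSum p g ∎
    where
    f : ℕ → Carrier
    f u = q ^^ (p ∸ u) * S₂ (suc p) (suc u) * C (suc (suc u)) g
    term : ℕ → Carrier
    term u = q ^^ (p ∸ u) * S₂ p u * C (suc u) (shift g) - q * (q ^^ (p ∸ u) * S₂ p u * C (suc u) g)
    χ : ℕ → Carrier
    χ v = q ^^ (suc p ∸ v) * fromℕ v * S₂ p v * C (suc v) g
    χ0≈0 : χ 0 ≈ 0#
    χ0≈0 = trans (*-congʳ (x*0*y≈0 _ _)) (zeroˡ _)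
    χp≈0 : χ (suc p) ≈ 0#
    χp≈0 = trans (*-congʳ (*-congˡ (S₂-vanishes (ℕₚ.n<1+n p)))) (x*0*y≈0 _ _)
    split : ∀ u → u ≤ p → f u ≈ term u + (χ (suc u) - χ u)
    split u u≤p = begin
      f u ≈⟨ *-cong (*-congˡ (S₂-suc p u)) (C-suc (suc u) g) ⟩
      _   ≈⟨ solve 7 (λ Q q a S₁ S₀ c₁ c₀ →
               Q :* ((con (+ 1) :+ a) :* S₁ :+ S₀) :* (c₁ :- q :* (con (+ 1) :+ a) :* c₀)
               := (Q :* S₀ :* c₁ :- q :* (Q :* S₀ :* c₀))
                  :+ (Q :* (con (+ 1) :+ a) :* S₁ :* (c₁ :- q :* (con (+ 1) :+ a) :* c₀) :- (q :* Q) :* a :* S₀ :* c₀))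
               refl (q ^^ (p ∸ u)) q (fromℕ u) (S₂ p (suc u)) (S₂ p u) (C (suc u) (shift g)) (C (suc u) g) ⟩
      _   ≈⟨ +-congˡ (+-cong (*-congˡ (sym (C-suc (suc u) g)))
                             (-‿cong (*-congʳ (*-congʳ (*-congʳ (sym (^^-suc-∸ q u≤p))))))) ⟩
      term u + (χ (suc u) - χ u) ∎

  stirling-inversion : ∀ p g → inversionSum p g ≈ Δ p g
  stirling-inversion zero    g =
    solve 3 (λ q x y → con (+ 1) :* (con (+ 1) :+ con (+ 0))
                         :* (con (+ 0) :* (q :* con (+ 1)) :* x :+ (con (+ 1) :+ con (+ 0)) :* con (+ 1) :* y)
                     := y) refl q (g 0) (g 1)
  stirling-inversion (suc p) g = trans (inversionSum-suc p g)
    (+-cong (stirling-inversion p (shift g)) (-‿cong (*-congˡ (stirling-inversion p g))))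

  fubini-Δ : ∀ n g → fubini (suc n) q (λ i → Δ (i ∸ 1) g) ≈ fubini (suc n) (- q) g
  fubini-Δ zero    g = refl
  fubini-Δ (suc n) g = begin
    fubini (suc (suc n)) q (λ i → Δ (i ∸ 1) g)          ≈⟨ fubini-suc n q _ ⟩
    fubini (suc n) q (fubiniStep q (λ i → Δ (i ∸ 1) g)) ≈⟨ fubini-cong (suc n) q (λ p _ → sym (Δ-fubiniStep p g)) ⟩
    fubini (suc n) q (λ i → Δ (i ∸ 1) (fubiniStep (- q) g))
                                                        ≈⟨ fubini-Δ n (fubiniStep (- q) g) ⟩
    fubini (suc n) (- q) (fubiniStep (- q) g)           ≈⟨ fubini-suc n (- q) g ⟨
    fubini (suc (suc n)) (- q) g                        ∎

  padded-stirling-inversion : ∀ p d g →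
    sum1 (suc p ℕ.+ d) (λ j → q ^^ (suc p ℕ.+ d ∸ j) * S₂ p (j ∸ 1) * C j g) ≈ q ^^ d * Δ p g
  padded-stirling-inversion p d g = begin
    sum1 (suc p ℕ.+ d) (λ j → q ^^ (suc p ℕ.+ d ∸ j) * S₂ p (j ∸ 1) * C j g)
        ≈⟨ sum1-suc (p ℕ.+ d) _ ⟩
    sum0 (p ℕ.+ d) (λ j → q ^^ (p ℕ.+ d ∸ j) * S₂ p j * C (suc j) g)
        ≈⟨ sum0-vanishing-tail p d _ (λ i p<i → trans (*-congʳ (*-congˡ (S₂-vanishes p<i))) (x*0*y≈0 _ _)) ⟩
    sum0 p (λ j → q ^^ (p ℕ.+ d ∸ j) * S₂ p j * C (suc j) g)
        ≈⟨ sum0-cong p (λ j j≤p → trans (*-congʳ (*-congʳ (split-power j≤p)))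
             (solve 4 (λ x y s c → x :* y :* s :* c := y :* (x :* s :* c)) refl _ _ _ _)) ⟩
    sum0 p (λ j → q ^^ d * (q ^^ (p ∸ j) * S₂ p j * C (suc j) g))
        ≈⟨ sum0-distribˡ p _ _ ⟨
    q ^^ d * inversionSum p g
        ≈⟨ *-congˡ (stirling-inversion p g) ⟩
    q ^^ d * Δ p g ∎
    where
    split-power : ∀ {j} → j ≤ p → q ^^ (p ℕ.+ d ∸ j) ≈ q ^^ (p ∸ j) * q ^^ d
    split-power {j} j≤p = trans (reflexive (≡.cong (q ^^_) (ℕₚ.+-∸-comm d j≤p))) (^^-+ q (p ∸ j) d)

  coeffB-sum≈fubini : ∀ n g →
    sum1 n (λ j → q ^^ (n ∸ j) * sum1 n (λ i → fromℕ (coeffB n i j)) * C j g) ≈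
    fubini n q (λ i → Δ (i ∸ 1) g)
  coeffB-sum≈fubini n g = begin
    sum1 n (λ j → q ^^ (n ∸ j) * sum1 n (λ i → fromℕ (coeffB n i j)) * C j g)
        ≈⟨ sum1-cong n (λ j _ → expand (suc j)) ⟩
    sum1 n (λ j → sum1 n (λ i → A i * (q ^^ (n ∸ j) * S₂ (i ∸ 1) (j ∸ 1) * C j g)))
        ≈⟨ sum1-comm n n _ ⟩
    sum1 n (λ i → sum1 n (λ j → A i * (q ^^ (n ∸ j) * S₂ (i ∸ 1) (j ∸ 1) * C j g)))
        ≈⟨ sum1-cong n (λ p p<n → trans (sym (sum1-distribˡ n _ _)) (*-congˡ (inner p<n))) ⟩
    sum1 n (λ i → A i * (q ^^ (n ∸ i) * Δ (i ∸ 1) g))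
        ≈⟨ sum1-cong n (λ _ _ → sym (*-assoc _ _ _)) ⟩
    fubini n q (λ i → Δ (i ∸ 1) g) ∎
    where
    A : ℕ → Carrier
    A i = fromℕ (surjections n i)
    expand : ∀ j → q ^^ (n ∸ j) * sum1 n (λ i → fromℕ (coeffB n i j)) * C j g ≈
                   sum1 n (λ i → A i * (q ^^ (n ∸ j) * S₂ (i ∸ 1) (j ∸ 1) * C j g))
    expand j = begin
      q ^^ (n ∸ j) * sum1 n (λ i → fromℕ (coeffB n i j)) * C j g
          ≈⟨ *-congʳ (*-congˡ (sum1-cong n (λ p _ → fromℕ-* (surjections n (suc p)) (stirling2 p (j ∸ 1))))) ⟩
      q ^^ (n ∸ j) * sum1 n (λ i → A i * S₂ (i ∸ 1) (j ∸ 1)) * C j g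
          ≈⟨ *-congʳ (sum1-distribˡ n _ _) ⟩
      sum1 n (λ i → q ^^ (n ∸ j) * (A i * S₂ (i ∸ 1) (j ∸ 1))) * C j g
          ≈⟨ sum1-distribʳ n _ _ ⟩
      sum1 n (λ i → q ^^ (n ∸ j) * (A i * S₂ (i ∸ 1) (j ∸ 1)) * C j g)
          ≈⟨ sum1-cong n (λ p _ → solve 4 (λ x a s c → x :* (a :* s) :* c := a :* (x :* s :* c)) refl _ _ _ _) ⟩
      sum1 n (λ i → A i * (q ^^ (n ∸ j) * S₂ (i ∸ 1) (j ∸ 1) * C j g)) ∎
    inner : ∀ {p} → suc p ≤ n →
            sum1 n (λ j → q ^^ (n ∸ j) * S₂ p (j ∸ 1) * C j g) ≈ q ^^ (n ∸ suc p) * Δ p g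
    inner {p} p<n with ℕₚ.m≤n⇒∃[o]m+o≡n p<n
    ... | d , ≡.refl = trans (padded-stirling-inversion p d g) (*-congʳ (reflexive (≡.cong (q ^^_) (≡.sym (ℕₚ.m+n∸m≡n (suc p) d)))))

module Specialisation {c ℓ} (F : Field c ℓ) (k m : ℕ) (a q la : FieldDefs.Carrier F)
                      (L : Vec (FieldDefs.Carrier F) k) where
  open FieldDefs F
  open Arithmetic F
  open Fubini F
  open StirlingTransform F q
  open import Relation.Binary.Reasoning.Setoid setoid

  prefactor : Carrier
  prefactor = (a + fromℕ m) ^^ k / a ^^ k

  weight : ℕ → Carrier
  weight t = (la * prod L ^^ t) * ((a + fromℕ m + fromℕ t) ^^ k) ⁻¹

  𝓑≈fubini : ∀ n → 𝓑 k (suc n) m a q L la ≈ prefactor * fubini (suc n) (- q) weight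
  𝓑≈fubini n = *-congˡ (begin
    sum0 (suc n) (λ i → term i * (la * prod L ^^ i) / (a + fromℕ m + fromℕ i) ^^ k)
        ≈⟨ sum0-cong (suc n) (λ i _ → *-assoc _ _ _) ⟩
    sum0 (suc n) (λ i → term i * weight i)  ≈⟨ sum0≈head+sum1 (suc n) _ ⟩
    0# * _ * weight 0 + fubini (suc n) (- q) weight
        ≈⟨ trans (+-congʳ (0*x*y≈0 _ _)) (+-identityˡ _) ⟩
    fubini (suc n) (- q) weight ∎)
    where
    term : ℕ → Carrier
    term i = fromℕ (surjections (suc n) i) * (- q) ^^ (suc n ∸ i)

  𝓒≈C : (∀ j → ¬ (a + fromℕ j ≈ 0#)) → ∀ j → 𝓒 k j m a q L la ≈ prefactor * C j weight
  𝓒≈C a+j≉0 j = *-congˡ (sum0-cong j (λ t _ → trans (*-assoc _ _ _) (*-congˡ (*-congˡ (denominator t)))))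
    where
    denominator : ∀ t → ((a + fromℕ t + fromℕ m) ^^ k) ⁻¹ ≈ ((a + fromℕ m + fromℕ t) ^^ k) ⁻¹
    denominator t = ⁻¹-cong
      (^^-nonzero k (λ a+m+t≈0 → a+j≉0 (m ℕ.+ t) (trans (trans (+-congˡ (fromℕ-+ m t)) (sym (+-assoc _ _ _))) a+m+t≈0)))
      (^^-cong k (solve 3 (λ a x y → a :+ x :+ y := a :+ y :+ x) refl a (fromℕ t) (fromℕ m)))

-- The identity itself needs none of the other hypotheses.
theorem9 : ∀ {c ℓ} (F : Field c ℓ) →
    let open FieldDefs F in
    (k : ℕ) → 1 ≤ k →
    (a q la : Carrier) (L : Vec Carrier k) →
    ¬ (a ≈ 0#) → ¬ (q ≈ 0#) → All (λ x → ¬ (x ≈ 0#)) L →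
    (∀ (j : ℕ) → ¬ (a + fromℕ j ≈ 0#)) →
    (n m : ℕ) → 1 ≤ n →
    𝓑 k n m a q L la ≈
      sum1 n (λ j → q ^^ (n ∸ j) *
        sum1 n (λ i → fromℕ (coeffB n i j))
          * 𝓒 k j m a q L la)
theorem9 F k _ a q la L _ _ _ a+j≉0 (suc n) m _ = begin
  𝓑 k (suc n) m a q L la                             ≈⟨ 𝓑≈fubini n ⟩
  prefactor * fubini (suc n) (- q) weight            ≈⟨ *-congˡ (fubini-Δ n weight) ⟨
  prefactor * fubini (suc n) q (λ i → Δ (i ∸ 1) weight)
                                                     ≈⟨ *-congˡ (coeffB-sum≈fubini (suc n) weight) ⟨
  prefactor * sum1 (suc n) (λ j → q ^^ (suc n ∸ j) * coefficient j * C j weight)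
                                                     ≈⟨ sum1-distribˡ (suc n) prefactor _ ⟩
  sum1 (suc n) (λ j → prefactor * (q ^^ (suc n ∸ j) * coefficient j * C j weight))
                                                     ≈⟨ sum1-cong (suc n) (λ j _ → move-prefactor (suc j)) ⟩
  sum1 (suc n) (λ j → q ^^ (suc n ∸ j) * coefficient j * 𝓒 k j m a q L la) ∎
  where
  open FieldDefs F
  open Arithmetic F
  open Fubini F
  open StirlingTransform F q
  open Specialisation F k m a q la L
  open import Relation.Binary.Reasoning.Setoid setoid
  coefficient : ℕ → Carrier
  coefficient j = sum1 (suc n) (λ i → fromℕ (coeffB (suc n) i j))
  move-prefactor : ∀ j → prefactor * (q ^^ (suc n ∸ j) * coefficient j * C j weight) ≈
                         q ^^ (suc n ∸ j) * coefficient j * 𝓒 k j m a q L la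
  move-prefactor j = trans
    (solve 4 (λ K x y z → K :* (x :* y :* z) := x :* y :* (K :* z)) refl _ _ _ _)
    (*-congˡ (sym (𝓒≈C a+j≉0 j)))
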